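{- Let $C_n$ be the cycle on $n\ge 3$ vertices. Then $C_2(C_n)=4$ if $n$ is even and $C_2(C_n)=3$ if $n$ is odd.
   Context: All graphs are finite, simple and undirected. A set $S\subseteq V(G)$ is a $2$-dominating set of $G$ if every vertex of $V(G)\setminus S$ has at least $2$ neighbours in $S$. Two sets $U_1,U_2\subseteq V(G)$ form a $2$-coalition if neither $U_1$ nor $U_2$ is a $2$-dominating set of $G$, but $U_1\cup U_2$ is. A $2$-coalition partition of $G$ is a partition $\Theta$ of $V(G)$ into nonempty sets such that every set of $\Theta$ either is a $2$-dominating set of $G$ with exactly $2$ elements, or forms a $2$-coalition with some other set of $\Theta$. The $2$-coalition number $C_2(G)$ is the maximum number of sets in a $2$-coalition partition of $G$. -}

module Defs where

open import Data.Nat using (ℕ; zero; suc; _≤_)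
open import Data.Fin using (Fin; toℕ)
open import Data.Product using (Σ; ∃; _×_; _,_)
open import Data.Sum using (_⊎_)
open import Relation.Nullary using (¬_)
open import Relation.Binary.PropositionalEquality using (_≡_; _≢_)
open import Function.Definitions using (Surjective)
open import Function.Bundles using (_⇔_)

Graph : ℕ → Set₁
Graph n = Fin n → Fin n → Set

VSet : ℕ → Set₁
VSet n = Fin n → Set

_∪_ : ∀ {n} → VSet n → VSet n → VSet n
(U ∪ W) v = U v ⊎ W v

TwoDominating : ∀ {n} → Graph n → VSet n → Set
TwoDominating {n} G S =
  (v : Fin n) → ¬ S v →
  Σ (Fin n) λ u → Σ (Fin n) λ w → u ≢ w × G v u × G v w × S u × S w

TwoCoalition : ∀ {n} → Graph n → VSet n → VSet n → Set
TwoCoalition G U W =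
  ¬ TwoDominating G U × ¬ TwoDominating G W × TwoDominating G (U ∪ W)

HasExactlyTwo : ∀ {n} → VSet n → Set
HasExactlyTwo {n} S =
  Σ (Fin n) λ a → Σ (Fin n) λ b → a ≢ b × ((v : Fin n) → S v ⇔ (v ≡ a ⊎ v ≡ b))

Class : ∀ {n k} → (Fin n → Fin k) → Fin k → VSet n
Class f i v = f v ≡ i

-- A partition of V(G) into k nonempty sets is encoded by a surjective map
-- f : Fin n → Fin k (the sets are the fibres of f).
IsTwoCoalitionPartition : ∀ {n} → Graph n → (k : ℕ) → (Fin n → Fin k) → Set
IsTwoCoalitionPartition G k f =
  Surjective _≡_ _≡_ f ×
  ((i : Fin k) →
     (TwoDominating G (Class f i) × HasExactlyTwo (Class f i))
     ⊎ (Σ (Fin k) λ j → i ≢ j × TwoCoalition G (Class f i) (Class f j)))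

TwoCoalitionNumber : ∀ {n} → Graph n → ℕ → Set
TwoCoalitionNumber {n} G m =
  (Σ (Fin n → Fin m) λ f → IsTwoCoalitionPartition G m f) ×
  ((k : ℕ) (f : Fin n → Fin k) → IsTwoCoalitionPartition G k f → k ≤ m)

Cycle : (n : ℕ) → Graph n
Cycle n i j =
  suc (toℕ i) ≡ toℕ j ⊎ suc (toℕ j) ≡ toℕ i
  ⊎ (toℕ i ≡ 0 × suc (toℕ j) ≡ n) ⊎ (toℕ j ≡ 0 × suc (toℕ i) ≡ n)

-- On a cycle of length n ≥ 3 a vertex set is 2-dominating exactly when it meets every edge
-- {v, v+1}, i.e. is a vertex cover. For n ≥ 5 a two-element set is never a vertex cover, so in a
-- 2-coalition partition every class is a non-cover that becomes a cover together with a partner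
-- class. An edge has only two endpoints, so a class that forms a cover with three other classes is
-- already a cover by itself. With five or more classes this, applied to three classes outside a
-- class and its partner, gives a contradiction; with four classes the partner relation must be a
-- perfect matching, i.e. two disjoint vertex covers, which alternate along the cycle and force n to
-- be even. Conversely the colourings 0,2,1,3,1,3,… (n even) and 0,1,2,1,2,… (n odd) are 2-coalition
-- partitions with 4 and 3 classes, and for n ≤ 4 the number of classes is at most n.

module Submission where

open import Defs
import Data.Nat as ℕ
open import Data.Nat using (ℕ; zero; suc; _≤_; _<_; z≤n; s≤s; _≤?_)
open import Data.Nat.Properties
  using (≤-trans; <-irrefl; ≰⇒>; ≤∧≢⇒<; <⇒≤pred; suc-injective; n<1+n; n≤1+n; ≤-pred; 1+n≢0; m≢1+n+m; <⇒≤; <⇒≱; m≤n⇒m<n∨m≡n)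
open import Data.Nat.Divisibility using (_∣_; _∤_; divides; _∣0; n∣n; ∣m∣n⇒∣m+n; ∣m+n∣m⇒∣n; ∣1⇒≡1)
open import Data.Fin using (Fin; zero; suc; toℕ; fromℕ; fromℕ<; inject₁; inject≤; punchIn; punchOut; _≟_)
open import Data.Fin.Patterns using (0F; 1F; 2F; 3F)
open import Data.Fin.Properties
  using (toℕ-injective; toℕ<n; toℕ-fromℕ<; toℕ-fromℕ; toℕ-inject₁; injective⇒≤; inject≤-injective;
         punchIn-injective; punchInᵢ≢i; punchIn-punchOut)
open import Data.Product using (Σ; ∃; _×_; _,_; proj₁; proj₂)
open import Data.Sum using (_⊎_; inj₁; inj₂; swap; [_,_])
import Data.Sum as Sum
open import Data.Empty using (⊥; ⊥-elim)
open import Relation.Nullary using (¬_; Dec; yes; no)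
open import Relation.Nullary.Decidable using (_⊎-dec_)
open import Relation.Binary.PropositionalEquality
  using (_≡_; _≢_; refl; sym; trans; cong; subst; ≢-sym; module ≡-Reasoning)
open import Function.Base using (_∘_)
open import Function.Bundles using (Equivalence)
open import Function.Definitions using (Injective; Surjective)

2∣n⇒2∣2+n : ∀ {m} → 2 ∣ m → 2 ∣ suc (suc m)
2∣n⇒2∣2+n = ∣m∣n⇒∣m+n n∣n

2∣2+n⇒2∣n : ∀ {m} → 2 ∣ suc (suc m) → 2 ∣ m
2∣2+n⇒2∣n 2∣2+m = ∣m+n∣m⇒∣n 2∣2+m n∣n

2∤1 : 2 ∤ 1
2∤1 2∣1 with ∣1⇒≡1 2∣1
... | ()

2∣n⇒2∤1+n : ∀ {m} → 2 ∣ m → 2 ∤ suc m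
2∣n⇒2∤1+n {zero}        _   = 2∤1
2∣n⇒2∤1+n {suc zero}    2∣1 = ⊥-elim (2∤1 2∣1)
2∣n⇒2∤1+n {suc (suc m)} 2∣m = 2∣n⇒2∤1+n (2∣2+n⇒2∣n 2∣m) ∘ 2∣2+n⇒2∣n

module Avoiding {m} {Z W : Fin (suc (suc m))} (Z≢W : Z ≢ W) where

  avoid : Fin m → Fin (suc (suc m))
  avoid j = punchIn Z (punchIn (punchOut Z≢W) j)

  avoid-injective : Injective _≡_ _≡_ avoid
  avoid-injective {i} {j} = punchIn-injective _ i j ∘ punchIn-injective Z _ _

  avoid≢Z : ∀ j → avoid j ≢ Z
  avoid≢Z _ = punchInᵢ≢i Z _

  avoid≢W : ∀ j → avoid j ≢ W
  avoid≢W j e = punchInᵢ≢i _ j (punchIn-injective Z _ _ (trans e (sym (punchIn-punchOut Z≢W))))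

  avoid-surjective : ∀ {Y} → Y ≢ Z → Y ≢ W → ∃ λ j → avoid j ≡ Y
  avoid-surjective {Y} Y≢Z Y≢W =
    punchOut W′≢Y′ , trans (cong (punchIn Z) (punchIn-punchOut W′≢Y′)) (punchIn-punchOut (≢-sym Y≢Z))
    where
    W′≢Y′ : punchOut Z≢W ≢ punchOut (≢-sym Y≢Z)
    W′≢Y′ e =
      Y≢W (trans (sym (punchIn-punchOut (≢-sym Y≢Z))) (trans (cong (punchIn Z) (sym e)) (punchIn-punchOut Z≢W)))

three-avoiding : ∀ {k} {Z W : Fin k} → 5 ≤ k → Z ≢ W →
                 Σ (Fin 3 → Fin k) λ X → Injective _≡_ _≡_ X × (∀ i → X i ≢ Z × X i ≢ W)
three-avoiding (s≤s (s≤s 3≤m)) Z≢W =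
  (λ i → avoid (inject≤ i 3≤m)) ,
  (λ {i} {j} e → inject≤-injective 3≤m 3≤m i j (avoid-injective e)) ,
  (λ i → avoid≢Z _ , avoid≢W _)
  where open Avoiding Z≢W

surjective⇒≥ : ∀ {n k} {f : Fin n → Fin k} → Surjective _≡_ _≡_ f → k ≤ n
surjective⇒≥ {f = f} surj = injective⇒≤ λ {i} {j} e →
  trans (sym (proj₂ (surj i) refl)) (trans (cong f e) (proj₂ (surj j) refl))

module VertexCovers {n : ℕ} (next : Fin n → Fin n) where

  VertexCover : VSet n → Set
  VertexCover S = ∀ v → S v ⊎ S (next v)

  next-in-cover : ∀ {S} → VertexCover S → ∀ {v} → ¬ S v → S (next v)
  next-in-cover cover {v} ¬Sv with cover v
  ... | inj₁ Sv  = ⊥-elim (¬Sv Sv)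
  ... | inj₂ Snv = Snv

  in-cover-before : ∀ {S} → VertexCover S → ∀ {v} → ¬ S (next v) → S v
  in-cover-before cover {v} ¬Snv with cover v
  ... | inj₁ Sv  = Sv
  ... | inj₂ Snv = ⊥-elim (¬Snv Snv)

  cover⊆pair⇒n≤4 : Injective _≡_ _≡_ next → ∀ {S} (a b : Fin n) →
                   (∀ v → S v → v ≡ a ⊎ v ≡ b) → VertexCover S → n ≤ 4
  cover⊆pair⇒n≤4 next-injective {S} a b S⊆ab cover = injective⇒≤ label-injective
    where
    At : Fin 4 → Fin n → Set
    At 0F v = v ≡ a
    At 1F v = v ≡ b
    At 2F v = next v ≡ a
    At 3F v = next v ≡ b

    At-unique : ∀ l {v w} → At l v → At l w → v ≡ w
    At-unique 0F e e′ = trans e (sym e′)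
    At-unique 1F e e′ = trans e (sym e′)
    At-unique 2F e e′ = next-injective (trans e (sym e′))
    At-unique 3F e e′ = next-injective (trans e (sym e′))

    labelled : ∀ v → Σ (Fin 4) λ l → At l v
    labelled v with cover v
    ... | inj₁ Sv with S⊆ab v Sv
    ...   | inj₁ e = 0F , e
    ...   | inj₂ e = 1F , e
    labelled v | inj₂ Snv with S⊆ab (next v) Snv
    ...   | inj₁ e = 2F , e
    ...   | inj₂ e = 3F , e

    label-injective : Injective _≡_ _≡_ (proj₁ ∘ labelled)
    label-injective {v} {w} e =
      At-unique (proj₁ (labelled w)) (subst (λ l → At l v) e (proj₂ (labelled v))) (proj₂ (labelled w))

  module _ {k} (f : Fin n → Fin k) where

    Covers : Fin k → Fin k → Set
    Covers A B = VertexCover (Class f A ∪ Class f B)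

    covers-sym : ∀ {A B} → Covers A B → Covers B A
    covers-sym cover = Sum.map swap swap ∘ cover

    covers-at : ∀ {A B} → Covers A B → ∀ v → f v ≢ B → f (next v) ≢ B → f v ≡ A ⊎ f (next v) ≡ A
    covers-at cover v v≢B v′≢B with cover v
    ... | inj₁ (inj₁ e) = inj₁ e
    ... | inj₁ (inj₂ e) = ⊥-elim (v≢B e)
    ... | inj₂ (inj₁ e) = inj₂ e
    ... | inj₂ (inj₂ e) = ⊥-elim (v′≢B e)

    -- Pigeonhole: an edge missing C has only two endpoints to meet three disjoint classes.
    covered-by-three : ∀ {A₁ A₂ A₃ C} → A₁ ≢ A₂ → A₁ ≢ A₃ → A₂ ≢ A₃ →
                       Covers A₁ C → Covers A₂ C → Covers A₃ C → VertexCover (Class f C)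
    covered-by-three {C = C} A₁≢A₂ A₁≢A₃ A₂≢A₃ c₁ c₂ c₃ v with f v ≟ C | f (next v) ≟ C
    ... | yes e | _     = inj₁ e
    ... | no _  | yes e = inj₂ e
    ... | no v≢C | no v′≢C
      with covers-at c₁ v v≢C v′≢C | covers-at c₂ v v≢C v′≢C | covers-at c₃ v v≢C v′≢C
    ... | inj₁ e₁ | inj₁ e₂ | _       = ⊥-elim (A₁≢A₂ (trans (sym e₁) e₂))
    ... | inj₂ e₁ | inj₂ e₂ | _       = ⊥-elim (A₁≢A₂ (trans (sym e₁) e₂))
    ... | inj₁ e₁ | inj₂ _  | inj₁ e₃ = ⊥-elim (A₁≢A₃ (trans (sym e₁) e₃))
    ... | inj₂ e₁ | inj₁ _  | inj₂ e₃ = ⊥-elim (A₁≢A₃ (trans (sym e₁) e₃))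
    ... | inj₁ _  | inj₂ e₂ | inj₂ e₃ = ⊥-elim (A₂≢A₃ (trans (sym e₂) e₃))
    ... | inj₂ _  | inj₁ e₂ | inj₁ e₃ = ⊥-elim (A₂≢A₃ (trans (sym e₂) e₃))

    -- The vertex-cover form of a 2-coalition partition of a cycle of length at least 5.
    record Pairing : Set where
      field
        partner         : Fin k → Fin k
        partner-≢       : ∀ i → i ≢ partner i
        class-not-cover : ∀ i → ¬ VertexCover (Class f i)
        covers-partner  : ∀ i → Covers i (partner i)

    module _ (pairing : Pairing) where
      open Pairing pairing

      successors-in-partner : ∀ {A} u w → f u ≢ f w → f u ≢ A → f w ≢ A →
                              f (next u) ≢ A → f (next w) ≢ A → f (next u) ≢ f w → f (next w) ≢ f u →
                              f (next u) ≡ partner A × f (next w) ≡ partner A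
      successors-in-partner u w u≢w u≢A w≢A u′≢A w′≢A u′≢w w′≢u
        with covers-at (covers-sym (covers-partner _)) u u≢A u′≢A
           | covers-at (covers-sym (covers-partner _)) w w≢A w′≢A
      ... | inj₁ eu  | inj₁ ew  = ⊥-elim (u≢w (trans eu (sym ew)))
      ... | inj₁ eu  | inj₂ ew′ = ⊥-elim (w′≢u (trans ew′ (sym eu)))
      ... | inj₂ eu′ | inj₁ ew  = ⊥-elim (u′≢w (trans eu′ (sym ew)))
      ... | inj₂ eu′ | inj₂ ew′ = eu′ , ew′

      -- Covering each class with its partner at representatives of the other two classes forces
      -- all three partners to equal the successors' classes, hence to coincide.
      no-three-classes-with-outer-successors :
        (u : Fin 3 → Fin n) → (∀ i j → i ≢ j → f (u i) ≢ f (u j)) →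
        (∀ i j → f (next (u i)) ≢ f (u j)) → ⊥
      no-three-classes-with-outer-successors u distinct outer =
        class-not-cover C (covered-by-three (distinct 0F 1F (λ ())) (distinct 0F 2F (λ ())) (distinct 1F 2F (λ ()))
          (covers-partner (f (u 0F)))
          (subst (Covers (f (u 1F))) partner₁≡C (covers-partner (f (u 1F))))
          (subst (Covers (f (u 2F))) partner₂≡C (covers-partner (f (u 2F)))))
        where
        C : Fin k
        C = partner (f (u 0F))
        shared : ∀ a b c → a ≢ b → a ≢ c → b ≢ c →
                 f (next (u b)) ≡ partner (f (u a)) × f (next (u c)) ≡ partner (f (u a))
        shared a b c a≢b a≢c b≢c = successors-in-partner (u b) (u c)
          (distinct b c b≢c) (distinct b a (≢-sym a≢b)) (distinct c a (≢-sym a≢c))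
          (outer b a) (outer c a) (outer b c) (outer c b)
        shared₀ : f (next (u 1F)) ≡ C × f (next (u 2F)) ≡ C
        shared₀ = shared 0F 1F 2F (λ ()) (λ ()) (λ ())
        partner₁≡C : partner (f (u 1F)) ≡ C
        partner₁≡C = trans (sym (proj₂ (shared 1F 0F 2F (λ ()) (λ ()) (λ ())))) (proj₂ shared₀)
        partner₂≡C : partner (f (u 2F)) ≡ C
        partner₂≡C = trans (sym (proj₂ (shared 2F 0F 1F (λ ()) (λ ()) (λ ())))) (proj₁ shared₀)

      -- Z and its partner form a cover, so successors of vertices in classes other than these two
      -- lie in these two.
      no-five-classes : Surjective _≡_ _≡_ f → 5 ≤ k → Fin k → ⊥
      no-five-classes surj 5≤k Z with three-avoiding 5≤k (partner-≢ Z)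
      ... | X , X-injective , X-avoids = no-three-classes-with-outer-successors u distinct outer
        where
        u : Fin 3 → Fin n
        u i = proj₁ (surj (X i))
        f∘u : ∀ i → f (u i) ≡ X i
        f∘u i = proj₂ (surj (X i)) refl
        distinct : ∀ i j → i ≢ j → f (u i) ≢ f (u j)
        distinct i j i≢j e = i≢j (X-injective (trans (sym (f∘u i)) (trans e (f∘u j))))
        outer : ∀ i j → f (next (u i)) ≢ f (u j)
        outer i j e with covers-partner Z (u i)
        ... | inj₁ (inj₁ e′) = proj₁ (X-avoids i) (trans (sym (f∘u i)) e′)
        ... | inj₁ (inj₂ e′) = proj₂ (X-avoids i) (trans (sym (f∘u i)) e′)
        ... | inj₂ (inj₁ e′) = proj₁ (X-avoids j) (trans (sym (f∘u j)) (trans (sym e) e′))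
        ... | inj₂ (inj₂ e′) = proj₂ (X-avoids j) (trans (sym (f∘u j)) (trans (sym e) e′))

      pairing⇒size≤4 : Surjective _≡_ _≡_ f → k ≤ 4
      pairing⇒size≤4 surj with k ≤? 4
      ... | yes k≤4 = k≤4
      ... | no k≰4 = ⊥-elim (no-five-classes surj 5≤k (fromℕ< (≤-trans (s≤s z≤n) 5≤k)))
        where
        5≤k : 5 ≤ k
        5≤k = ≰⇒> k≰4

stripe : {A : Set} → A → A → ℕ → A
stripe x y zero    = x
stripe x y (suc j) = stripe y x j

stripe-hits : {A : Set} (x y : A) → ∀ j → stripe x y j ≡ x ⊎ stripe x y (suc j) ≡ x
stripe-hits x y zero    = inj₁ refl
stripe-hits x y (suc j) = swap (stripe-hits x y j)

stripe-odd : {A : Set} (x y : A) → ∀ {j} → 2 ∤ j → stripe x y j ≡ y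
stripe-odd x y {zero}        2∤0 = ⊥-elim (2∤0 (2 ∣0))
stripe-odd x y {suc zero}    _   = refl
stripe-odd x y {suc (suc j)} 2∤j = stripe-odd x y (2∤j ∘ 2∣n⇒2∣2+n)

evenColouring : ℕ → Fin 4
evenColouring zero          = 0F
evenColouring (suc zero)    = 2F
evenColouring (suc (suc j)) = stripe 1F 3F j

evenColouring-last : ∀ {m} → 2 ≤ m → 2 ∣ suc m → evenColouring m ≡ 3F
evenColouring-last {suc zero} (s≤s ())
evenColouring-last {suc (suc j)} _ 2∣3+j = stripe-odd 1F 3F λ 2∣j → 2∣n⇒2∤1+n 2∣j (2∣2+n⇒2∣n 2∣3+j)

oddColouring : ℕ → Fin 3
oddColouring zero    = 0F
oddColouring (suc j) = stripe 1F 2F j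

oddColouring-last : ∀ {m} → 1 ≤ m → 2 ∤ suc m → oddColouring m ≡ 2F
oddColouring-last {suc j} _ 2∤2+j = stripe-odd 1F 2F (2∤2+j ∘ 2∣n⇒2∣2+n)

module CycleGraph (N : ℕ) where

  1+v<n : ∀ v → toℕ v ≢ N → suc (toℕ v) < suc N
  1+v<n v v≢N = s≤s (≤∧≢⇒< (≤-pred (toℕ<n v)) v≢N)

  next : Fin (suc N) → Fin (suc N)
  next v with toℕ v ℕ.≟ N
  ... | yes _   = zero
  ... | no v≢N = fromℕ< (1+v<n v v≢N)

  data NextView (v : Fin (suc N)) : Fin (suc N) → Set where
    step : ∀ {w} → suc (toℕ v) < suc N → toℕ w ≡ suc (toℕ v) → NextView v w
    wrap : ∀ {w} → toℕ v ≡ N → w ≡ zero → NextView v w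

  next-view : ∀ v → NextView v (next v)
  next-view v with toℕ v ℕ.≟ N
  ... | yes v≡N = wrap v≡N refl
  ... | no v≢N  = step (1+v<n v v≢N) (toℕ-fromℕ< (1+v<n v v≢N))

  toℕ-next : ∀ v → suc (toℕ v) < suc N → toℕ (next v) ≡ suc (toℕ v)
  toℕ-next v p with next-view v
  ... | step _ e = e
  ... | wrap e _ = ⊥-elim (<-irrefl (cong suc e) p)

  next-last : ∀ v → toℕ v ≡ N → next v ≡ zero
  next-last v e with next-view v
  ... | step p _ = ⊥-elim (<-irrefl (cong suc e) p)
  ... | wrap _ z = z

  next-fromℕ< : ∀ {j} (1+j<n : suc j < suc N) → next (fromℕ< (<⇒≤ 1+j<n)) ≡ fromℕ< 1+j<n
  next-fromℕ< {j} 1+j<n = toℕ-injective (begin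
    toℕ (next v)       ≡⟨ toℕ-next v (subst (λ x → suc x < suc N) (sym (toℕ-fromℕ< _)) 1+j<n) ⟩
    suc (toℕ v)        ≡⟨ cong suc (toℕ-fromℕ< _) ⟩
    suc j              ≡⟨ sym (toℕ-fromℕ< 1+j<n) ⟩
    toℕ (fromℕ< 1+j<n) ∎)
    where
    open ≡-Reasoning
    v : Fin (suc N)
    v = fromℕ< (<⇒≤ 1+j<n)

  next-injective : Injective _≡_ _≡_ next
  next-injective {u} {w} e with next-view u | next-view w
  ... | step _ eu | step _ ew = toℕ-injective (suc-injective (trans (sym eu) (trans (cong toℕ e) ew)))
  ... | wrap eu _ | wrap ew _ = toℕ-injective (trans eu (sym ew))
  ... | step _ eu | wrap _ zw = ⊥-elim (1+n≢0 (trans (sym eu) (cong toℕ (trans e zw))))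
  ... | wrap _ zu | step _ ew = ⊥-elim (1+n≢0 (trans (sym ew) (cong toℕ (trans (sym e) zu))))

  prev : Fin (suc N) → Fin (suc N)
  prev zero    = fromℕ N
  prev (suc i) = inject₁ i

  next-prev : ∀ v → next (prev v) ≡ v
  next-prev zero    = next-last (fromℕ N) (toℕ-fromℕ N)
  next-prev (suc i) = toℕ-injective (trans (toℕ-next (inject₁ i) i+1<n) (cong suc (toℕ-inject₁ i)))
    where
    i+1<n : suc (toℕ (inject₁ i)) < suc N
    i+1<n = subst (λ x → suc x < suc N) (sym (toℕ-inject₁ i)) (s≤s (toℕ<n i))

  next²≢id : 2 ≤ N → ∀ v → next (next v) ≢ v
  next²≢id 2≤N v e with next-view v
  ... | wrap v≡N nv≡0 = <-irrefl (trans (sym (toℕ-next zero 1<n)) (trans (cong toℕ e′) v≡N)) 2≤N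
    where
    1<n : 1 < suc N
    1<n = ≤-trans 2≤N (n≤1+n N)
    e′ : next zero ≡ v
    e′ = trans (cong next (sym nv≡0)) e
  ... | step _ e₁ with next-view (next v)
  ...   | step _ e₂ = m≢1+n+m (toℕ v) (trans (sym (cong toℕ e)) (trans e₂ (cong suc e₁)))
  ...   | wrap nv≡N nnv≡0 = <-irrefl (trans (cong suc (sym v≡0)) (trans (sym e₁) nv≡N)) 2≤N
    where
    v≡0 : toℕ v ≡ 0
    v≡0 = trans (sym (cong toℕ e)) (cong toℕ nnv≡0)

  next≢prev : 2 ≤ N → ∀ v → next v ≢ prev v
  next≢prev 2≤N v e = next²≢id 2≤N v (trans (cong next e) (next-prev v))

  Cycle-sym : ∀ {u v} → Cycle (suc N) u v → Cycle (suc N) v u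
  Cycle-sym (inj₁ e)                = inj₂ (inj₁ e)
  Cycle-sym (inj₂ (inj₁ e))         = inj₁ e
  Cycle-sym (inj₂ (inj₂ (inj₁ e)))  = inj₂ (inj₂ (inj₂ e))
  Cycle-sym (inj₂ (inj₂ (inj₂ e)))  = inj₂ (inj₂ (inj₁ e))

  adjacent-next : ∀ v → Cycle (suc N) v (next v)
  adjacent-next v with next-view v
  ... | step _ e = inj₁ (sym e)
  ... | wrap e z = inj₂ (inj₂ (inj₂ (cong toℕ z , cong suc e)))

  adjacent-prev : ∀ v → Cycle (suc N) v (prev v)
  adjacent-prev v = Cycle-sym (subst (Cycle (suc N) (prev v)) (next-prev v) (adjacent-next (prev v)))

  suc-toℕ⇒next : ∀ {v u} → suc (toℕ v) ≡ toℕ u → u ≡ next v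
  suc-toℕ⇒next {v} {u} e = toℕ-injective (trans (sym e) (sym (toℕ-next v (subst (_< suc N) (sym e) (toℕ<n u)))))

  last-zero⇒next : ∀ {v u} → toℕ u ≡ 0 → suc (toℕ v) ≡ suc N → u ≡ next v
  last-zero⇒next {v} z e = toℕ-injective (trans z (cong toℕ (sym (next-last v (suc-injective e)))))

  adjacent⇒next : ∀ {v u} → Cycle (suc N) v u → u ≡ next v ⊎ v ≡ next u
  adjacent⇒next (inj₁ e)                     = inj₁ (suc-toℕ⇒next e)
  adjacent⇒next (inj₂ (inj₁ e))              = inj₂ (suc-toℕ⇒next e)
  adjacent⇒next (inj₂ (inj₂ (inj₁ (z , e)))) = inj₂ (last-zero⇒next z e)
  adjacent⇒next (inj₂ (inj₂ (inj₂ (z , e)))) = inj₁ (last-zero⇒next z e)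

  open VertexCovers next public

  twoDominating⇒cover : ∀ {S} → (∀ v → Dec (S v)) → TwoDominating (Cycle (suc N)) S → VertexCover S
  twoDominating⇒cover S? dom v with S? v
  ... | yes Sv = inj₁ Sv
  ... | no ¬Sv with dom v ¬Sv
  ... | u , w , u≢w , v~u , v~w , Su , Sw with adjacent⇒next v~u | adjacent⇒next v~w
  ...   | inj₁ u≡nv | _         = inj₂ (subst _ u≡nv Su)
  ...   | inj₂ _    | inj₁ w≡nv = inj₂ (subst _ w≡nv Sw)
  ...   | inj₂ v≡nu | inj₂ v≡nw = ⊥-elim (u≢w (next-injective (trans (sym v≡nu) v≡nw)))

  cover⇒twoDominating : 2 ≤ N → ∀ {S} → VertexCover S → TwoDominating (Cycle (suc N)) S
  cover⇒twoDominating 2≤N {S} cover v ¬Sv =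
    next v , prev v , next≢prev 2≤N v , adjacent-next v , adjacent-prev v ,
    next-in-cover {S} cover ¬Sv , in-cover-before {S} cover (¬Sv ∘ subst S (next-prev v))

  two-colouring-walk : ∀ {P Q : VSet (suc N)} → (∀ {v} → P v → Q (next v)) → (∀ {v} → Q v → P (next v)) →
                       P zero → ∀ j (j<n : j < suc N) →
                       (2 ∣ j × P (fromℕ< j<n)) ⊎ (2 ∣ suc j × Q (fromℕ< j<n))
  two-colouring-walk P→Q Q→P P₀ zero    _     = inj₁ (2 ∣0 , P₀)
  two-colouring-walk {P} {Q} P→Q Q→P P₀ (suc j) 1+j<n
    with two-colouring-walk {P} {Q} P→Q Q→P P₀ j (<⇒≤ 1+j<n)
  ... | inj₁ (2∣j , Pj)    = inj₂ (2∣n⇒2∣2+n 2∣j , subst Q (next-fromℕ< 1+j<n) (P→Q Pj))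
  ... | inj₂ (2∣1+j , Qj)  = inj₁ (2∣1+j , subst P (next-fromℕ< 1+j<n) (Q→P Qj))

  two-colouring⇒even : ∀ {P Q : VSet (suc N)} → (∀ {v} → P v → Q (next v)) → (∀ {v} → Q v → P (next v)) →
                       P zero → ¬ Q zero → 2 ∣ suc N
  two-colouring⇒even {P} {Q} P→Q Q→P P₀ ¬Q₀ with two-colouring-walk {P} {Q} P→Q Q→P P₀ N (n<1+n N)
  ... | inj₁ (_ , P-last) = ⊥-elim (¬Q₀ (subst Q (next-last _ (toℕ-fromℕ< (n<1+n N))) (P→Q P-last)))
  ... | inj₂ (2∣n , _)    = 2∣n

  disjoint-covers⇒even : ∀ {S T} → VertexCover S → VertexCover T → (∀ {v} → S v → ¬ T v) → 2 ∣ suc N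
  disjoint-covers⇒even {S} {T} S-cover T-cover disjoint = [ from-S₀ , from-T₀ ∘ S₁⇒T₀ ] (S-cover zero)
    where
    S→T : ∀ {v} → S v → T (next v)
    S→T = next-in-cover {T} T-cover ∘ disjoint
    T→S : ∀ {v} → T v → S (next v)
    T→S Tv = next-in-cover {S} S-cover (λ Sv → disjoint Sv Tv)
    from-S₀ : S zero → 2 ∣ suc N
    from-S₀ S₀ = two-colouring⇒even {S} {T} S→T T→S S₀ (disjoint S₀)
    from-T₀ : T zero → 2 ∣ suc N
    from-T₀ T₀ = two-colouring⇒even {T} {S} T→S S→T T₀ (λ S₀ → disjoint S₀ T₀)
    S₁⇒T₀ : S (next zero) → T zero
    S₁⇒T₀ S₁ = in-cover-before {T} T-cover (disjoint S₁)

  disjoint-pairs⇒even : ∀ {k} (f : Fin (suc N) → Fin k) {A B C D} → A ≢ C → A ≢ D → B ≢ C → B ≢ D →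
                        Covers f A B → Covers f C D → 2 ∣ suc N
  disjoint-pairs⇒even f {A} {B} {C} {D} A≢C A≢D B≢C B≢D AB-cover CD-cover =
    disjoint-covers⇒even {Class f A ∪ Class f B} {Class f C ∪ Class f D} AB-cover CD-cover disjoint
    where
    disjoint : ∀ {v} → (Class f A ∪ Class f B) v → ¬ (Class f C ∪ Class f D) v
    disjoint (inj₁ a) (inj₁ c) = A≢C (trans (sym a) c)
    disjoint (inj₁ a) (inj₂ d) = A≢D (trans (sym a) d)
    disjoint (inj₂ b) (inj₁ c) = B≢C (trans (sym b) c)
    disjoint (inj₂ b) (inj₂ d) = B≢D (trans (sym b) d)

  module FourClasses (f : Fin (suc N) → Fin 4) (pairing : Pairing f) where
    open Pairing pairing
    open Avoiding (partner-≢ 0F)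

    Z W X₁ X₂ : Fin 4
    Z = 0F
    W = partner 0F
    X₁ = avoid 0F
    X₂ = avoid 1F

    X₁≢X₂ : X₁ ≢ X₂
    X₁≢X₂ e with avoid-injective e
    ... | ()

    exhaustive : ∀ Y → Y ≡ Z ⊎ Y ≡ W ⊎ Y ≡ X₁ ⊎ Y ≡ X₂
    exhaustive Y with Y ≟ Z | Y ≟ W
    ... | yes e  | _      = inj₁ e
    ... | no _   | yes e  = inj₂ (inj₁ e)
    ... | no Y≢Z | no Y≢W with avoid-surjective Y≢Z Y≢W
    ...   | 0F , e = inj₂ (inj₂ (inj₁ (sym e)))
    ...   | 1F , e = inj₂ (inj₂ (inj₂ (sym e)))

    covers-with : ∀ X {Y} → partner X ≡ Y → Covers f X Y
    covers-with X e = subst (Covers f X) e (covers-partner X)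

    -- The partner relation on the four classes is either a perfect matching, which 2-colours
    -- the cycle, or a star, whose centre would be a vertex cover by itself.
    four-classes⇒even : 2 ∣ suc N
    four-classes⇒even with exhaustive (partner X₁) | exhaustive (partner X₂)
    ... | inj₂ (inj₂ (inj₁ e)) | _                    = ⊥-elim (partner-≢ X₁ (sym e))
    ... | _                    | inj₂ (inj₂ (inj₂ e)) = ⊥-elim (partner-≢ X₂ (sym e))
    ... | inj₂ (inj₂ (inj₂ e)) | _                    =
      disjoint-pairs⇒even f (≢-sym (avoid≢Z _)) (≢-sym (avoid≢Z _)) (≢-sym (avoid≢W _)) (≢-sym (avoid≢W _))
        (covers-partner Z) (covers-with X₁ e)
    ... | _                    | inj₂ (inj₂ (inj₁ e)) =
      disjoint-pairs⇒even f (≢-sym (avoid≢Z _)) (≢-sym (avoid≢Z _)) (≢-sym (avoid≢W _)) (≢-sym (avoid≢W _))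
        (covers-partner Z) (covers-with X₂ e)
    ... | inj₁ e₁        | inj₁ e₂        = ⊥-elim (class-not-cover Z
      (covered-by-three f X₁≢X₂ (avoid≢W _) (avoid≢W _)
        (covers-with X₁ e₁) (covers-with X₂ e₂) (covers-sym f (covers-partner Z))))
    ... | inj₂ (inj₁ e₁) | inj₂ (inj₁ e₂) = ⊥-elim (class-not-cover W
      (covered-by-three f X₁≢X₂ (avoid≢Z _) (avoid≢Z _)
        (covers-with X₁ e₁) (covers-with X₂ e₂) (covers-partner Z)))
    ... | inj₁ e₁        | inj₂ (inj₁ e₂) =
      disjoint-pairs⇒even f X₁≢X₂ (avoid≢W _) (≢-sym (avoid≢Z _)) (partner-≢ Z)
        (covers-with X₁ e₁) (covers-with X₂ e₂)
    ... | inj₂ (inj₁ e₁) | inj₁ e₂        =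
      disjoint-pairs⇒even f X₁≢X₂ (avoid≢Z _) (≢-sym (avoid≢W _)) (≢-sym (partner-≢ Z))
        (covers-with X₁ e₁) (covers-with X₂ e₂)

  open FourClasses public using (four-classes⇒even)

  class? : ∀ {k} (f : Fin (suc N) → Fin k) i v → Dec (Class f i v)
  class? f i v = f v ≟ i

  partition⇒pairing : 5 ≤ suc N → ∀ {k} {f : Fin (suc N) → Fin k} →
                      IsTwoCoalitionPartition (Cycle (suc N)) k f → Pairing f
  partition⇒pairing (s≤s 4≤N) {k} {f} (_ , classes) = record
    { partner         = proj₁ ∘ coalition
    ; partner-≢       = proj₁ ∘ proj₂ ∘ coalition
    ; class-not-cover = proj₁ ∘ proj₂ ∘ proj₂ ∘ coalition
    ; covers-partner  = proj₂ ∘ proj₂ ∘ proj₂ ∘ coalition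
    }
    where
    coalition : ∀ i → Σ (Fin k) λ j → i ≢ j × ¬ VertexCover (Class f i) × Covers f i j
    coalition i with classes i
    ... | inj₁ (dom , a , b , _ , i⇔ab) =
      ⊥-elim (<⇒≱ (s≤s 4≤N) (cover⊆pair⇒n≤4 next-injective a b (λ v → Equivalence.to (i⇔ab v))
                                             (twoDominating⇒cover (class? f i) dom)))
    ... | inj₂ (j , i≢j , ¬dom-i , _ , dom-ij) =
      j , i≢j , ¬dom-i ∘ cover⇒twoDominating (≤-trans (s≤s (s≤s z≤n)) 4≤N) ,
      twoDominating⇒cover (λ v → class? f i v ⊎-dec class? f j v) dom-ij

  pairing⇒partition : 2 ≤ N → ∀ {k} {f : Fin (suc N) → Fin k} → Surjective _≡_ _≡_ f →
                      Pairing f → IsTwoCoalitionPartition (Cycle (suc N)) k f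
  pairing⇒partition 2≤N {f = f} surj pairing = surj , λ i →
    inj₂ (partner i , partner-≢ i , ¬dom i , ¬dom (partner i) , cover⇒twoDominating 2≤N (covers-partner i))
    where
    open Pairing pairing
    ¬dom : ∀ i → ¬ TwoDominating (Cycle (suc N)) (Class f i)
    ¬dom i = class-not-cover i ∘ twoDominating⇒cover (class? f i)

  partition-size≤4 : ∀ {k} {f : Fin (suc N) → Fin k} → IsTwoCoalitionPartition (Cycle (suc N)) k f → k ≤ 4
  partition-size≤4 {f = f} partition with suc N ≤? 4
  ... | yes n≤4 = ≤-trans (surjective⇒≥ (proj₁ partition)) n≤4
  ... | no n≰4  = pairing⇒size≤4 f (partition⇒pairing (≰⇒> n≰4) partition) (proj₁ partition)

  odd-partition-size≤3 : 2 ∤ suc N → ∀ {k} {f : Fin (suc N) → Fin k} →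
                         IsTwoCoalitionPartition (Cycle (suc N)) k f → k ≤ 3
  odd-partition-size≤3 2∤n {k} partition with suc N ≤? 3
  ... | yes n≤3 = ≤-trans (surjective⇒≥ (proj₁ partition)) n≤3
  ... | no n≰3  = <⇒≤pred (≤∧≢⇒< (partition-size≤4 partition) k≢4)
    where
    5≤n : 5 ≤ suc N
    5≤n with m≤n⇒m<n∨m≡n (≰⇒> n≰3)
    ... | inj₁ 4<n = 4<n
    ... | inj₂ 4≡n = ⊥-elim (2∤n (subst (2 ∣_) 4≡n (divides 2 refl)))
    k≢4 : k ≢ 4
    k≢4 refl = 2∤n (four-classes⇒even _ (partition⇒pairing 5≤n partition))

  module Colouring {k} (c : ℕ → Fin k) where

    colour : Fin (suc N) → Fin k
    colour v = c (toℕ v)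

    InPair : Fin k → Fin k → ℕ → Set
    InPair a b j = c j ≡ a ⊎ c j ≡ b

    colour-surjective : (∀ i → Σ ℕ λ j → j < suc N × c j ≡ i) → Surjective _≡_ _≡_ colour
    colour-surjective hit i with hit i
    ... | j , j<n , cj≡i = fromℕ< j<n , λ e → trans (cong colour e) (trans (cong c (toℕ-fromℕ< j<n)) cj≡i)

    covers-ℕ : ∀ {a b} → (∀ j → InPair a b j ⊎ InPair a b (suc j)) → InPair a b N ⊎ InPair a b 0 →
               Covers colour a b
    covers-ℕ {a} {b} consecutive wrap-around v with next-view v
    ... | step _ e   = Sum.map₂ (subst (InPair a b) (sym e)) (consecutive (toℕ v))
    ... | wrap e z   = Sum.map (subst (InPair a b) (sym e)) (subst (InPair a b ∘ toℕ) (sym z)) wrap-around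

    not-cover-at : ∀ {a} j → suc j < suc N → c j ≢ a → c (suc j) ≢ a → ¬ VertexCover (Class colour a)
    not-cover-at {a} j 1+j<n cj≢a c1+j≢a cover with cover (fromℕ< (<⇒≤ 1+j<n))
    ... | inj₁ e = cj≢a (subst (λ x → c x ≡ a) (toℕ-fromℕ< _) e)
    ... | inj₂ e =
      c1+j≢a (subst (λ x → c x ≡ a) (toℕ-fromℕ< 1+j<n) (subst (Class colour a) (next-fromℕ< 1+j<n) e))

    not-cover-wrap : ∀ {a} → c N ≢ a → c 0 ≢ a → ¬ VertexCover (Class colour a)
    not-cover-wrap {a} cN≢a c0≢a cover with cover (fromℕ N)
    ... | inj₁ e = cN≢a (subst (λ x → c x ≡ a) (toℕ-fromℕ N) e)
    ... | inj₂ e = c0≢a (subst (Class colour a) (next-last _ (toℕ-fromℕ N)) e)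

  module EvenColouring (2∣n : 2 ∣ suc N) (3≤N : 3 ≤ N) where
    open Colouring evenColouring

    partner : Fin 4 → Fin 4
    partner 0F = 1F
    partner 1F = 0F
    partner 2F = 3F
    partner 3F = 2F

    partner-≢ : ∀ i → i ≢ partner i
    partner-≢ 0F ()
    partner-≢ 1F ()
    partner-≢ 2F ()
    partner-≢ 3F ()

    even-vertices : ∀ j → InPair 0F 1F j ⊎ InPair 0F 1F (suc j)
    even-vertices zero          = inj₁ (inj₁ refl)
    even-vertices (suc zero)    = inj₂ (inj₂ refl)
    even-vertices (suc (suc j)) = Sum.map inj₂ inj₂ (stripe-hits 1F 3F j)

    odd-vertices : ∀ j → InPair 2F 3F j ⊎ InPair 2F 3F (suc j)
    odd-vertices zero          = inj₂ (inj₁ refl)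
    odd-vertices (suc zero)    = inj₁ (inj₁ refl)
    odd-vertices (suc (suc j)) = Sum.map inj₂ inj₂ (stripe-hits 3F 1F (suc j))

    3<n : 3 < suc N
    3<n = s≤s 3≤N

    class-not-cover : ∀ i → ¬ VertexCover (Class colour i)
    class-not-cover 0F = not-cover-at 2 3<n (λ ()) (λ ())
    class-not-cover 1F = not-cover-at 0 (≤-trans (s≤s (s≤s z≤n)) 3<n) (λ ()) (λ ())
    class-not-cover 2F = not-cover-at 2 3<n (λ ()) (λ ())
    class-not-cover 3F = not-cover-at 0 (≤-trans (s≤s (s≤s z≤n)) 3<n) (λ ()) (λ ())

    covers-partner : ∀ i → Covers colour i (partner i)
    covers-partner 0F = covers-ℕ even-vertices (inj₂ (inj₁ refl))
    covers-partner 1F = covers-sym colour (covers-partner 0F)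
    covers-partner 2F = covers-ℕ odd-vertices (inj₁ (inj₂ (evenColouring-last (≤-trans (n≤1+n 2) 3≤N) 2∣n)))
    covers-partner 3F = covers-sym colour (covers-partner 2F)

    hit : ∀ i → Σ ℕ λ j → j < suc N × evenColouring j ≡ i
    hit 0F = 0 , ≤-trans (s≤s z≤n) 3<n , refl
    hit 1F = 2 , ≤-trans (n≤1+n 3) 3<n , refl
    hit 2F = 1 , ≤-trans (s≤s (s≤s z≤n)) 3<n , refl
    hit 3F = 3 , 3<n , refl

    partition : IsTwoCoalitionPartition (Cycle (suc N)) 4 colour
    partition = pairing⇒partition (≤-trans (n≤1+n 2) 3≤N) (colour-surjective hit)
      record { partner = partner ; partner-≢ = partner-≢
             ; class-not-cover = class-not-cover ; covers-partner = covers-partner }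

  module OddColouring (2∤n : 2 ∤ suc N) (2≤N : 2 ≤ N) where
    open Colouring oddColouring

    partner : Fin 3 → Fin 3
    partner 0F = 1F
    partner 1F = 0F
    partner 2F = 0F

    partner-≢ : ∀ i → i ≢ partner i
    partner-≢ 0F ()
    partner-≢ 1F ()
    partner-≢ 2F ()

    zero-or-odd : ∀ j → InPair 0F 1F j ⊎ InPair 0F 1F (suc j)
    zero-or-odd zero    = inj₁ (inj₁ refl)
    zero-or-odd (suc j) = Sum.map inj₂ inj₂ (stripe-hits 1F 2F j)

    zero-or-even : ∀ j → InPair 0F 2F j ⊎ InPair 0F 2F (suc j)
    zero-or-even zero    = inj₁ (inj₁ refl)
    zero-or-even (suc j) = Sum.map inj₂ inj₂ (stripe-hits 2F 1F (suc j))

    2<n : 2 < suc N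
    2<n = s≤s 2≤N

    1<n : 1 < suc N
    1<n = ≤-trans (n≤1+n 2) 2<n

    last≡2 : oddColouring N ≡ 2F
    last≡2 = oddColouring-last (≤-trans (s≤s z≤n) 2≤N) 2∤n

    class-not-cover : ∀ i → ¬ VertexCover (Class colour i)
    class-not-cover 0F = not-cover-at 1 2<n (λ ()) (λ ())
    class-not-cover 1F = not-cover-wrap (λ e → 2≢1 (trans (sym last≡2) e)) (λ ())
      where
      2≢1 : 2F ≢ 1F
      2≢1 ()
    class-not-cover 2F = not-cover-at 0 1<n (λ ()) (λ ())

    covers-partner : ∀ i → Covers colour i (partner i)
    covers-partner 0F = covers-ℕ zero-or-odd (inj₂ (inj₁ refl))
    covers-partner 1F = covers-sym colour (covers-partner 0F)
    covers-partner 2F = covers-sym colour (covers-ℕ zero-or-even (inj₂ (inj₁ refl)))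

    hit : ∀ i → Σ ℕ λ j → j < suc N × oddColouring j ≡ i
    hit 0F = 0 , s≤s z≤n , refl
    hit 1F = 1 , 1<n , refl
    hit 2F = 2 , 2<n , refl

    partition : IsTwoCoalitionPartition (Cycle (suc N)) 3 colour
    partition = pairing⇒partition 2≤N (colour-surjective hit)
      record { partner = partner ; partner-≢ = partner-≢
             ; class-not-cover = class-not-cover ; covers-partner = covers-partner }

corollary5 : (n : ℕ) → 3 ≤ n →
    (2 ∣ n → TwoCoalitionNumber (Cycle n) 4) × (¬ (2 ∣ n) → TwoCoalitionNumber (Cycle n) 3)
corollary5 (suc N) (s≤s 2≤N) = even , odd
  where
  open CycleGraph N

  even : 2 ∣ suc N → TwoCoalitionNumber (Cycle (suc N)) 4
  even 2∣n = (_ , EvenColouring.partition 2∣n 3≤N) , λ _ _ → partition-size≤4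
    where
    3≤N : 3 ≤ N
    3≤N with m≤n⇒m<n∨m≡n 2≤N
    ... | inj₁ 2<N = 2<N
    ... | inj₂ 2≡N = ⊥-elim (2∣n⇒2∤1+n n∣n (subst (λ m → 2 ∣ suc m) (sym 2≡N) 2∣n))

  odd : 2 ∤ suc N → TwoCoalitionNumber (Cycle (suc N)) 3
  odd 2∤n = (_ , OddColouring.partition 2∤n 2≤N) , λ _ _ → odd-partition-size≤3 2∤n
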